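{- Let $C_0$ be an $\mathcal{ML}^n_{\mathcal{ALCO}_u}$-concept and $\mathfrak{F}$ a finite tree-shaped frame. Then $C_0$ is satisfiable in the root of a finite tree-shaped expanding-domain model based on $\mathfrak{F}$ iff there exists a quasimodel for $C_0$ based on $\mathfrak{F}$.
   Context: $\mathcal{ML}^n_{\mathcal{ALCO}_u}$-concepts: $C ::= A \mid \{a\} \mid \neg C \mid (C\sqcap C) \mid \exists r.C \mid \exists u.C \mid \Diamond_i C$, $1\le i\le n$. A finite tree-shaped frame is $\mathfrak{F}=(W,R_1,\ldots,R_n,R)$ where, for some $w_0$, $W$ is a finite prefix-closed set of words $w_0i_0w_1\cdots i_{m-1}w_m$ with $1\le i_j\le n$, $R_i=\{(\mathbf{w},\mathbf{w}iw)\mid \mathbf{w}iw\in W\}$, and $R$ is the transitive closure of $R_1\cup\cdots\cup R_n$; $w_0$ is the root. An expanding-domain model $(\mathfrak{F},\Delta,\mathcal{I})$ gives each $w$ a non-empty domain $\Delta^w$ with $\Delta^w\subseteq\Delta^v$ whenever $wRv$, and a DL interpretation $\mathcal{I}_w$ over $\Delta^w$ ($a^{\mathcal{I}_w}\in\Delta^w$, $u^{\mathcal{I}_w}=\Delta^w\times\Delta^w$), with $(\Diamond_iC)^{\mathcal{I}_w}=\{d\in\Delta^w\mid\exists v\,(wR_iv,\ d\in C^{\mathcal{I}_v})\}$; satisfiable in $w$ means $C^{\mathcal{I}_w}\neq\emptyset$. $\mathrm{con}(C_0)$ is the closure under single negation of the set of subconcepts of $C_0$. A type is $\mathbf{t}\subseteq\mathrm{con}(C_0)$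 with $\neg C\in\mathbf{t}$ iff $C\notin\mathbf{t}$, and $C\sqcap D\in\mathbf{t}$ iff $C,D\in\mathbf{t}$. Fix an enumeration $\mathbf{t}_1,\ldots,\mathbf{t}_k$ of all types. For $\mathbf{x}\in(\mathbb{N}\cup\{\infty\})^k$ let $|\mathbf{x}|=\sum_ix_i$. A quasistate is $\mathbf{x}=(x_1,\ldots,x_k)\in(\mathbb{N}\cup\{\infty\})^k$ with $|\mathbf{x}|>0$ such that: (Q1) for each $\{a\}\in\mathrm{con}(C_0)$, $\sum_{\{a\}\in\mathbf{t}_i}x_i=1$; (Q2) for each $x_i>0$ and $\exists r.C\in\mathbf{t}_i$ there is $x_j>0$ with $\{\neg D\mid\neg\exists r.D\in\mathbf{t}_i\}\cup\{C\}\subseteq\mathbf{t}_j$; (Q3) for each $x_i>0$: $\exists u.C\in\mathbf{t}_i$ iff there is $x_j>0$ with $C\in\mathbf{t}_j$. A basic structure is $(\mathfrak{F},\mathbf{q})$ with $\mathfrak{F}$ a finite tree-shaped frame with root $w_0$ and $\mathbf{q}$ assigning a quasistate to each world, such that some $i$ has $\mathbf{q}(w_0)_i>0$ and $C_0\in\mathbf{t}_i$. A set $V\subseteq W$ is $R$-closed if $v\in V$ whenever $w\in V$ and $wR_iv$ for some $i$. A run is a partial function $\rho:W\to\{1,\ldots,k\}$ with $R$-closed domain and $\mathbf{q}(w)_{\rho(w)}>0$ for $w$ in its domain, such that for each $\Diamond_iC\in\mathrm{con}(C_0)$: (R1) $\Diamond_iC\in\mathbf{t}_{\rho(w)}$ if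 some $v$ with $wR_iv$ has $C\in\mathbf{t}_{\rho(v)}$; (R2) if $\Diamond_iC\in\mathbf{t}_{\rho(w)}$ then some $v$ with $wR_iv$ has $C\in\mathbf{t}_{\rho(v)}$. A quasimodel for $C_0$ is $(\mathfrak{F},\mathbf{q},\mathfrak{R})$ with $(\mathfrak{F},\mathbf{q})$ a basic structure and $\mathfrak{R}$ a set of runs such that (M1) for every $w\in W$ and $i\le k$, $|\{\rho\in\mathfrak{R}\mid\rho(w)=i\}|=\mathbf{q}(w)_i$. -}

module Defs where

open import Level using (0ℓ)
open import Data.Nat as ℕ using (ℕ; zero; suc; _+_)
open import Data.Fin as Fin using (Fin)
open import Data.Fin.Subset using (Subset; _∈_)
open import Data.Fin.Subset.Properties using (_∈?_)
open import Data.Fin.Properties using (any?)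
open import Data.Bool as Bool using (Bool; true; false)
open import Data.Maybe using (Maybe; just; nothing)
open import Data.Maybe.Properties as MaybeP using ()
open import Data.Vec as Vec using (Vec; []; _∷_)
open import Data.Vec.Properties as VecP using ()
open import Data.List as List using (List; []; _∷_; _++_; [_]; length; lookup; filter; allFin; deduplicate)
open import Data.List.Properties as ListP using ()
open import Data.Product using (Σ; ∃; ∃-syntax; _×_; _,_; proj₁)
open import Data.Product.Properties as ProdP using ()
open import Data.Empty using (⊥)
open import Relation.Nullary using (¬_; Dec; yes; no)
open import Relation.Nullary.Decidable using (_×-dec_; True)
open import Relation.Binary.PropositionalEquality using (_≡_; _≢_; refl)
open import Relation.Binary.Definitions using (DecidableEquality)
open import Relation.Binary.Construct.Closure.Transitive using (TransClosure)
import Data.List.Membership.DecPropositional as DecMem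

-- Concepts of ML^n_{ALCO_u}.  Concept names, role names and individual
-- names are drawn from ℕ; modal indices 1..n are represented by Fin n.

infixr 6 _⊓_

data Concept (n : ℕ) : Set where
  atom : ℕ → Concept n
  nom  : ℕ → Concept n
  neg  : Concept n → Concept n
  _⊓_  : Concept n → Concept n → Concept n
  ∃r   : ℕ → Concept n → Concept n
  ∃u   : Concept n → Concept n
  ◇    : Fin n → Concept n → Concept n

module _ {n : ℕ} where
  infix 4 _≟C_
  _≟C_ : DecidableEquality (Concept n)
  (atom x0) ≟C (atom y0) with ℕ._≟_ x0 y0
  ... | yes refl = yes refl
  ... | no ne = no λ { refl → ne refl }
  (nom x0) ≟C (nom y0) with ℕ._≟_ x0 y0
  ... | yes refl = yes refl
  ... | no ne = no λ { refl → ne refl }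
  (neg x0) ≟C (neg y0) with _≟C_ x0 y0
  ... | yes refl = yes refl
  ... | no ne = no λ { refl → ne refl }
  (x0 ⊓ x1) ≟C (y0 ⊓ y1) with _≟C_ x0 y0 | _≟C_ x1 y1
  ... | yes refl | yes refl = yes refl
  ... | no ne | _ = no λ { refl → ne refl }
  ... | _ | no ne = no λ { refl → ne refl }
  (∃r x0 x1) ≟C (∃r y0 y1) with ℕ._≟_ x0 y0 | _≟C_ x1 y1
  ... | yes refl | yes refl = yes refl
  ... | no ne | _ = no λ { refl → ne refl }
  ... | _ | no ne = no λ { refl → ne refl }
  (∃u x0) ≟C (∃u y0) with _≟C_ x0 y0
  ... | yes refl = yes refl
  ... | no ne = no λ { refl → ne refl }
  (◇ x0 x1) ≟C (◇ y0 y1) with Fin._≟_ x0 y0 | _≟C_ x1 y1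
  ... | yes refl | yes refl = yes refl
  ... | no ne | _ = no λ { refl → ne refl }
  ... | _ | no ne = no λ { refl → ne refl }
  (atom _) ≟C (nom _) = no λ ()
  (atom _) ≟C (neg _) = no λ ()
  (atom _) ≟C (_ ⊓ _) = no λ ()
  (atom _) ≟C (∃r _ _) = no λ ()
  (atom _) ≟C (∃u _) = no λ ()
  (atom _) ≟C (◇ _ _) = no λ ()
  (nom _) ≟C (atom _) = no λ ()
  (nom _) ≟C (neg _) = no λ ()
  (nom _) ≟C (_ ⊓ _) = no λ ()
  (nom _) ≟C (∃r _ _) = no λ ()
  (nom _) ≟C (∃u _) = no λ ()
  (nom _) ≟C (◇ _ _) = no λ ()
  (neg _) ≟C (atom _) = no λ ()
  (neg _) ≟C (nom _) = no λ ()
  (neg _) ≟C (_ ⊓ _) = no λ ()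
  (neg _) ≟C (∃r _ _) = no λ ()
  (neg _) ≟C (∃u _) = no λ ()
  (neg _) ≟C (◇ _ _) = no λ ()
  (_ ⊓ _) ≟C (atom _) = no λ ()
  (_ ⊓ _) ≟C (nom _) = no λ ()
  (_ ⊓ _) ≟C (neg _) = no λ ()
  (_ ⊓ _) ≟C (∃r _ _) = no λ ()
  (_ ⊓ _) ≟C (∃u _) = no λ ()
  (_ ⊓ _) ≟C (◇ _ _) = no λ ()
  (∃r _ _) ≟C (atom _) = no λ ()
  (∃r _ _) ≟C (nom _) = no λ ()
  (∃r _ _) ≟C (neg _) = no λ ()
  (∃r _ _) ≟C (_ ⊓ _) = no λ ()
  (∃r _ _) ≟C (∃u _) = no λ ()
  (∃r _ _) ≟C (◇ _ _) = no λ ()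
  (∃u _) ≟C (atom _) = no λ ()
  (∃u _) ≟C (nom _) = no λ ()
  (∃u _) ≟C (neg _) = no λ ()
  (∃u _) ≟C (_ ⊓ _) = no λ ()
  (∃u _) ≟C (∃r _ _) = no λ ()
  (∃u _) ≟C (◇ _ _) = no λ ()
  (◇ _ _) ≟C (atom _) = no λ ()
  (◇ _ _) ≟C (nom _) = no λ ()
  (◇ _ _) ≟C (neg _) = no λ ()
  (◇ _ _) ≟C (_ ⊓ _) = no λ ()
  (◇ _ _) ≟C (∃r _ _) = no λ ()
  (◇ _ _) ≟C (∃u _) = no λ ()

sub : ∀ {n} → Concept n → List (Concept n)
sub c@(atom _)  = [ c ]
sub c@(nom _)   = [ c ]
sub c@(neg C)   = c ∷ sub C
sub c@(C ⊓ D)   = c ∷ sub C ++ sub D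
sub c@(∃r _ C)  = c ∷ sub C
sub c@(∃u C)    = c ∷ sub C
sub c@(◇ _ C)   = c ∷ sub C

∼_ : ∀ {n} → Concept n → Concept n
∼ neg C = C
∼ C     = neg C

con : ∀ {n} → Concept n → List (Concept n)
con C₀ = deduplicate _≟C_ (sub C₀ ++ List.map ∼_ (sub C₀))

∣con∣ : ∀ {n} → Concept n → ℕ
∣con∣ C₀ = length (con C₀)

-- a candidate type: a subset of con(C0) (given by positions in con C0)
Cand : ∀ {n} → Concept n → Set
Cand C₀ = Subset (∣con∣ C₀)

_≟S_ : ∀ {m} → DecidableEquality (Subset m)
_≟S_ = VecP.≡-dec Bool._≟_

_∈con_ : ∀ {n} → Concept n → Concept n → Set
C ∈con C₀ = Σ (Fin (∣con∣ C₀)) λ p → lookup (con C₀) p ≡ C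

member : ∀ {n} (C₀ : Concept n) → Concept n → Cand C₀ → Set
member C₀ C t = Σ (Fin (∣con∣ C₀)) λ p → lookup (con C₀) p ≡ C × p ∈ t

member? : ∀ {n} (C₀ : Concept n) (C : Concept n) (t : Cand C₀) → Dec (member C₀ C t)
member? C₀ C t = any? λ p → (lookup (con C₀) p ≟C C) ×-dec (p ∈? t)

_⟷_ : Set → Set → Set
A ⟷ B = (A → B) × (B → A)

IsType : ∀ {n} (C₀ : Concept n) → Cand C₀ → Set
IsType C₀ t =
  (∀ C → C ∈con C₀ → (member C₀ (∼ C) t ⟷ (¬ member C₀ C t))) ×
  (∀ C D → (C ⊓ D) ∈con C₀ → (member C₀ (C ⊓ D) t ⟷ (member C₀ C t × member C₀ D t)))

allSubsets : ∀ m → List (Subset m)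
allSubsets zero    = [ [] ]
allSubsets (suc m) = List.map (true ∷_) (allSubsets m) ++ List.map (false ∷_) (allSubsets m)

data ℕ∞ : Set where
  fin : ℕ → ℕ∞
  ∞   : ℕ∞

_+∞_ : ℕ∞ → ℕ∞ → ℕ∞
fin a +∞ fin b = fin (a + b)
_     +∞ _     = ∞

sum∞ : List ℕ∞ → ℕ∞
sum∞ = List.foldr _+∞_ (fin 0)

-- Quasistates.  A vector indexed by an enumeration of the types is
-- represented as a function on all subsets of con(C0) that vanishes
-- outside the types.

record Quasistate {n} (C₀ : Concept n) : Set where
  field
    x        : Cand C₀ → ℕ∞
    onTypes  : ∀ t → x t ≢ fin 0 → IsType C₀ t
    nonzero  : sum∞ (List.map x (allSubsets (∣con∣ C₀))) ≢ fin 0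
    Q1 : ∀ a → nom a ∈con C₀ →
         sum∞ (List.map x (filter (member? C₀ (nom a)) (allSubsets (∣con∣ C₀)))) ≡ fin 1
    Q2 : ∀ t → x t ≢ fin 0 → ∀ r C → member C₀ (∃r r C) t →
         ∃[ t′ ] (x t′ ≢ fin 0 × member C₀ C t′ ×
                  (∀ D → member C₀ (neg (∃r r D)) t → member C₀ (∼ D) t′))
    Q3 : ∀ t → x t ≢ fin 0 → ∀ C → ∃u C ∈con C₀ →
         (member C₀ (∃u C) t ⟷ (∃[ t′ ] (x t′ ≢ fin 0 × member C₀ C t′)))

-- Finite tree-shaped frames.  A world w0 i0 w1 … i_{m-1} w_m is
-- represented by its root letter w0 (fixed for the frame, a natural
-- number) and the list (i0,w1) … (i_{m-1},w_m).

Word : ℕ → Set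
Word n = List (Fin n × ℕ)

_≟W_ : ∀ {n} → DecidableEquality (Word n)
_≟W_ = ListP.≡-dec (ProdP.≡-dec Fin._≟_ ℕ._≟_)

record Frame (n : ℕ) : Set where
  field
    root      : ℕ
    words     : List (Word n)
    root∈     : DecMem._∈_ _≟W_ [] words
    prefixed  : ∀ w i v → DecMem._∈_ _≟W_ (w ++ [ (i , v) ]) words →
                DecMem._∈_ _≟W_ w words

module _ {n : ℕ} (F : Frame n) where
  open Frame F

  World : Set
  World = Σ (Word n) λ w → True (DecMem._∈?_ _≟W_ w words)

  rootW : World
  rootW = [] , Relation.Nullary.Decidable.fromWitness root∈

  Rᵢ : Fin n → World → World → Set
  Rᵢ i w v = ∃[ a ] (proj₁ v ≡ proj₁ w ++ [ (i , a) ])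

  R₁ₙ : World → World → Set
  R₁ₙ w v = ∃[ i ] Rᵢ i w v

  R : World → World → Set
  R = TransClosure R₁ₙ

record Model {n} (F : Frame n) : Set₁ where
  field
    D        : Set
    Δ        : World F → D → Set
    Δ-ne     : ∀ w → ∃[ d ] Δ w d
    expand   : ∀ {w v d} → R F w v → Δ w d → Δ v d
    conceptI : World F → ℕ → D → Set
    conceptI⊆Δ : ∀ w A d → conceptI w A d → Δ w d
    roleI    : World F → ℕ → D → D → Set
    roleI⊆Δ  : ∀ w r d e → roleI w r d e → Δ w d × Δ w e
    indI     : World F → ℕ → D
    indI∈Δ   : ∀ w a → Δ w (indI w a)

  ext : World F → Concept n → D → Set
  ext w (atom A) d = Δ w d × conceptI w A d
  ext w (nom a)  d = Δ w d × d ≡ indI w a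
  ext w (neg C)  d = Δ w d × ¬ ext w C d
  ext w (C ⊓ E)  d = ext w C d × ext w E d
  ext w (∃r r C) d = Δ w d × ∃[ e ] (Δ w e × roleI w r d e × ext w C e)
  ext w (∃u C)   d = Δ w d × ∃[ e ] (Δ w e × ext w C e)
  ext w (◇ i C)  d = Δ w d × ∃[ v ] (Rᵢ F i w v × ext v C d)

SatAtRoot : ∀ {n} → Concept n → Frame n → Set₁
SatAtRoot C₀ F = Σ (Model F) λ M → ∃[ d ] Model.ext M (rootW F) C₀ d

record BasicStructure {n} (C₀ : Concept n) (F : Frame n) : Set where
  field
    q      : World F → Quasistate C₀
    rootOK : ∃[ t ] (Quasistate.x (q (rootW F)) t ≢ fin 0 × member C₀ C₀ t)

  qx : World F → Cand C₀ → ℕ∞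
  qx w = Quasistate.x (q w)

record Run {n} {C₀ : Concept n} {F : Frame n} (B : BasicStructure C₀ F) : Set where
  open BasicStructure B
  field
    ρ      : World F → Maybe (Cand C₀)
    closed : ∀ w v t → ρ w ≡ just t → R₁ₙ F w v → ∃[ t′ ] (ρ v ≡ just t′)
    pos    : ∀ w t → ρ w ≡ just t → qx w t ≢ fin 0
    R1 : ∀ i C → ◇ i C ∈con C₀ → ∀ w t → ρ w ≡ just t →
         (∃[ v ] ∃[ t′ ] (Rᵢ F i w v × ρ v ≡ just t′ × member C₀ C t′)) →
         member C₀ (◇ i C) t
    R2 : ∀ i C → ◇ i C ∈con C₀ → ∀ w t → ρ w ≡ just t →
         member C₀ (◇ i C) t →
         ∃[ v ] ∃[ t′ ] (Rᵢ F i w v × ρ v ≡ just t′ × member C₀ C t′)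

record Quasimodel {n} (C₀ : Concept n) (F : Frame n) : Set where
  field
    basic : BasicStructure C₀ F
  open BasicStructure basic public
  field
    -- the set of runs, listed without repetition
    N        : ℕ
    runs     : Fin N → Run basic
    distinct : ∀ a b → (∀ w → Run.ρ (runs a) w ≡ Run.ρ (runs b) w) → a ≡ b
    M1 : ∀ w t →
         fin (length (filter (λ a → MaybeP.≡-dec _≟S_ (Run.ρ (runs a) w) (just t)) (allFin N)))
           ≡ qx w t

{-# OPTIONS --safe #-}

-- From a model: each element d gives a run, sending every world where d
-- exists to the set of concepts of con(C₀) that d satisfies there, which is
-- a type by excluded middle.  Elements with the same run are identified, so
-- there are finitely many runs even when the domain is infinite, and the
-- quasistate of w counts the runs through each type at w; Q1 holds because
-- a nominal denotes a single element.
--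
-- From a quasimodel: the runs become the domain elements, existing where
-- they are defined; atoms, roles (via the compatibility condition of Q2)
-- and nominals are read off the types the runs pass through, and induction
-- on the subconcepts of C₀ shows that a run satisfies at w exactly the
-- concepts of its type at w.

module Submission where

open import Defs
open import Level using (0ℓ)
open import Data.Nat using (ℕ)
open import Data.Product using (_×_)
open import Axiom.ExcludedMiddle using (ExcludedMiddle)

open import Data.Nat using (zero; suc)
open import Data.Fin as Fin using (Fin)
open import Data.Fin.Properties using (any?)
open import Data.Fin.Subset using () renaming (_∈_ to _∈ₛ_)
open import Data.Bool using (Bool; true; false)
open import Data.Bool.Properties using (T-≡; T-irrelevant)
open import Data.Maybe using (Maybe; just; nothing)
open import Data.Maybe.Properties using (just-injective)
import Data.Maybe.Properties as MaybeP
open import Data.Vec as Vec using (Vec; []; _∷_)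
import Data.Vec.Properties as VecP
open import Data.List as List using (List; []; _∷_; _++_; [_]; length; lookup; filter; allFin; deduplicate; cartesianProductWith)
open import Data.List.Properties using (filter-none)
open import Data.List.Membership.Propositional using (_∈_)
open import Data.List.Membership.Propositional.Properties
  using (∈-++⁻; ∈-++⁺ˡ; ∈-++⁺ʳ; ∈-map⁺; ∈-map⁻; ∈-deduplicate⁺; ∈-deduplicate⁻; ∈-lookup;
         ∈-filter⁺; ∈-filter⁻; ∈-allFin; ∈-cartesianProductWith⁺)
open import Data.List.Relation.Unary.Any as Any using (here; there)
import Data.List.Relation.Unary.Any.Properties as AnyP
open import Data.List.Relation.Unary.All as All using (All; []; _∷_)
open import Data.List.Relation.Unary.Unique.Propositional using (Unique)
import Data.List.Relation.Unary.Unique.Propositional.Properties as UniqueP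
import Data.List.Relation.Unary.Unique.DecPropositional.Properties as DecUniqueP
open import Data.List.Relation.Unary.AllPairs using ([]; _∷_)
open import Data.Product using (∃; ∃-syntax; _,_; proj₁; proj₂)
open import Data.Sum using (_⊎_; inj₁; inj₂)
open import Function using (_∘_; Equivalence)
open import Relation.Nullary using (¬_; Dec; yes; no; contradiction)
open import Relation.Nullary.Decidable using (isYes; fromWitness; toWitness; decidable-stable)
open import Relation.Unary using (Pred; Decidable)
open import Relation.Binary.PropositionalEquality using (_≡_; _≢_; refl; sym; trans; cong; cong₂; subst; module ≡-Reasoning)
open import Relation.Binary.Definitions using (DecidableEquality)
open import Relation.Binary.Construct.Closure.Transitive using (_∷_) renaming ([_] to [_]⁺)

module _ {n : ℕ} where

  sub-self : (C : Concept n) → C ∈ sub C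
  sub-self (atom _)  = here refl
  sub-self (nom _)   = here refl
  sub-self (neg _)   = here refl
  sub-self (_ ⊓ _)   = here refl
  sub-self (∃r _ _)  = here refl
  sub-self (∃u _)    = here refl
  sub-self (◇ _ _)   = here refl

  sub-trans : ∀ (C : Concept n) {D E} → D ∈ sub C → E ∈ sub D → E ∈ sub C
  sub-trans (atom _)  (here refl) E∈ = E∈
  sub-trans (nom _)   (here refl) E∈ = E∈
  sub-trans (neg _)   (here refl) E∈ = E∈
  sub-trans (_ ⊓ _)   (here refl) E∈ = E∈
  sub-trans (∃r _ _)  (here refl) E∈ = E∈
  sub-trans (∃u _)    (here refl) E∈ = E∈
  sub-trans (◇ _ _)   (here refl) E∈ = E∈
  sub-trans (neg C)   (there D∈) E∈ = there (sub-trans C D∈ E∈)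
  sub-trans (∃r _ C)  (there D∈) E∈ = there (sub-trans C D∈ E∈)
  sub-trans (∃u C)    (there D∈) E∈ = there (sub-trans C D∈ E∈)
  sub-trans (◇ _ C)   (there D∈) E∈ = there (sub-trans C D∈ E∈)
  sub-trans (C ⊓ C′)  (there D∈) E∈ with ∈-++⁻ (sub C) D∈
  ... | inj₁ D∈C  = there (∈-++⁺ˡ (sub-trans C D∈C E∈))
  ... | inj₂ D∈C′ = there (∈-++⁺ʳ (sub C) (sub-trans C′ D∈C′ E∈))

  ∼-cases : (C : Concept n) → ∼ C ≡ neg C ⊎ C ≡ neg (∼ C)
  ∼-cases (atom _)  = inj₁ refl
  ∼-cases (nom _)   = inj₁ refl
  ∼-cases (neg _)   = inj₂ refl
  ∼-cases (_ ⊓ _)   = inj₁ refl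
  ∼-cases (∃r _ _)  = inj₁ refl
  ∼-cases (∃u _)    = inj₁ refl
  ∼-cases (◇ _ _)   = inj₁ refl

module Subconcepts {n : ℕ} (C₀ : Concept n) where

  Sub : Concept n → Set
  Sub C = C ∈ sub C₀

  sub-neg : ∀ {C} → Sub (neg C) → Sub C
  sub-neg {C} p = sub-trans C₀ p (there (sub-self C))

  sub-⊓ˡ : ∀ {C D} → Sub (C ⊓ D) → Sub C
  sub-⊓ˡ {C} p = sub-trans C₀ p (there (∈-++⁺ˡ (sub-self C)))

  sub-⊓ʳ : ∀ {C D} → Sub (C ⊓ D) → Sub D
  sub-⊓ʳ {C} {D} p = sub-trans C₀ p (there (∈-++⁺ʳ (sub C) (sub-self D)))

  sub-∃r : ∀ {r C} → Sub (∃r r C) → Sub C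
  sub-∃r {C = C} p = sub-trans C₀ p (there (sub-self C))

  sub-∃u : ∀ {C} → Sub (∃u C) → Sub C
  sub-∃u {C} p = sub-trans C₀ p (there (sub-self C))

  sub-◇ : ∀ {i C} → Sub (◇ i C) → Sub C
  sub-◇ {C = C} p = sub-trans C₀ p (there (sub-self C))

  ∈con⇒∈ : ∀ {C} → C ∈con C₀ → C ∈ con C₀
  ∈con⇒∈ {C} (p , refl) = ∈-lookup p

  ∈⇒∈con : ∀ {C} → C ∈ con C₀ → C ∈con C₀
  ∈⇒∈con C∈ = Any.index C∈ , sym (AnyP.lookup-index C∈)

  sub⇒con : ∀ {C} → Sub C → C ∈con C₀
  sub⇒con p = ∈⇒∈con (∈-deduplicate⁺ _≟C_ (∈-++⁺ˡ p))

  sub⇒con∼ : ∀ {C} → Sub C → (∼ C) ∈con C₀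
  sub⇒con∼ p = ∈⇒∈con (∈-deduplicate⁺ _≟C_ (∈-++⁺ʳ (sub C₀) (∈-map⁺ ∼_ p)))

  con⇒sub⊎neg : ∀ {C} → C ∈con C₀ → Sub C ⊎ ∃[ E ] (C ≡ neg E × Sub E)
  con⇒sub⊎neg c with ∈-++⁻ (sub C₀) (∈-deduplicate⁻ _≟C_ (sub C₀ ++ List.map ∼_ (sub C₀)) (∈con⇒∈ c))
  ... | inj₁ p = inj₁ p
  ... | inj₂ ∼E∈ with ∈-map⁻ ∼_ ∼E∈
  ...   | E , p , refl with ∼-cases E
  ...     | inj₁ ∼E≡negE = inj₂ (E , ∼E≡negE , p)
  ...     | inj₂ E≡neg∼E = inj₁ (sub-neg (subst Sub E≡neg∼E p))

  ∼-con : ∀ {C} → C ∈con C₀ → (∼ C) ∈con C₀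
  ∼-con c with con⇒sub⊎neg c
  ... | inj₁ p              = sub⇒con∼ p
  ... | inj₂ (_ , refl , p) = sub⇒con p

  con⇒sub : ∀ {C} → C ∈con C₀ → (∀ E → C ≢ neg E) → Sub C
  con⇒sub c C≢neg with con⇒sub⊎neg c
  ... | inj₁ p                = p
  ... | inj₂ (E , C≡negE , _) = contradiction C≡negE (C≢neg E)

  neg-con⇒sub : ∀ {C} → neg C ∈con C₀ → Sub C
  neg-con⇒sub c with con⇒sub⊎neg c
  ... | inj₁ p              = sub-neg p
  ... | inj₂ (_ , refl , p) = p

  ⊓-con : ∀ {C D} → (C ⊓ D) ∈con C₀ → C ∈con C₀ × D ∈con C₀
  ⊓-con c = sub⇒con (sub-⊓ˡ p) , sub⇒con (sub-⊓ʳ p)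
    where p = con⇒sub c λ _ ()

  ∃r-con : ∀ {r C} → ∃r r C ∈con C₀ → C ∈con C₀
  ∃r-con c = sub⇒con (sub-∃r (con⇒sub c λ _ ()))

  ∃u-con : ∀ {C} → ∃u C ∈con C₀ → C ∈con C₀
  ∃u-con c = sub⇒con (sub-∃u (con⇒sub c λ _ ()))

  ◇-con : ∀ {i C} → ◇ i C ∈con C₀ → C ∈con C₀
  ◇-con c = sub⇒con (sub-◇ (con⇒sub c λ _ ()))

  ¬∃r-con : ∀ {r C} → neg (∃r r C) ∈con C₀ → (∼ C) ∈con C₀
  ¬∃r-con c = sub⇒con∼ (sub-∃r (neg-con⇒sub c))

  member⇒con : ∀ {C t} → member C₀ C t → C ∈con C₀
  member⇒con (p , eq , _) = p , eq

fin-injective : ∀ {a b} → fin a ≡ fin b → a ≡ b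
fin-injective refl = refl

+∞≡0 : ∀ a b → a +∞ b ≡ fin 0 → a ≡ fin 0 × b ≡ fin 0
+∞≡0 (fin 0) (fin 0) _ = refl , refl
+∞≡0 (fin 0) (fin (suc _)) ()
+∞≡0 (fin (suc _)) (fin _) ()
+∞≡0 (fin _) ∞ ()
+∞≡0 ∞ _ ()

+∞≡1 : ∀ a b → a +∞ b ≡ fin 1 → (a ≡ fin 1 × b ≡ fin 0) ⊎ (a ≡ fin 0 × b ≡ fin 1)
+∞≡1 (fin 0) (fin 1) _ = inj₂ (refl , refl)
+∞≡1 (fin 1) (fin 0) _ = inj₁ (refl , refl)
+∞≡1 (fin 0) (fin 0) ()
+∞≡1 (fin 0) (fin (suc (suc _))) ()
+∞≡1 (fin 1) (fin (suc _)) ()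
+∞≡1 (fin (suc (suc _))) (fin _) ()
+∞≡1 (fin _) ∞ ()
+∞≡1 ∞ _ ()

isZero? : (a : ℕ∞) → Dec (a ≡ fin 0)
isZero? (fin zero)    = yes refl
isZero? (fin (suc _)) = no λ ()
isZero? ∞             = no λ ()

module Sum∞ {A : Set} (x : A → ℕ∞) where

  Σx : List A → ℕ∞
  Σx xs = sum∞ (List.map x xs)

  Σx-positive : ∀ {xs s} → s ∈ xs → x s ≢ fin 0 → Σx xs ≢ fin 0
  Σx-positive {y ∷ ys} (here refl) x[s]≢0 Σ≡0 = x[s]≢0 (proj₁ (+∞≡0 (x y) (Σx ys) Σ≡0))
  Σx-positive {y ∷ ys} (there s∈) x[s]≢0 Σ≡0 = Σx-positive s∈ x[s]≢0 (proj₂ (+∞≡0 (x y) (Σx ys) Σ≡0))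

  Σx-positive⁻ : ∀ xs → Σx xs ≢ fin 0 → ∃[ s ] (s ∈ xs × x s ≢ fin 0)
  Σx-positive⁻ []       Σ≢0 = contradiction refl Σ≢0
  Σx-positive⁻ (y ∷ ys) Σ≢0 with isZero? (x y)
  ... | no x[y]≢0 = y , here refl , x[y]≢0
  ... | yes x[y]≡0 with Σx-positive⁻ ys (λ Σ≡0 → Σ≢0 (cong₂ _+∞_ x[y]≡0 Σ≡0))
  ...   | s , s∈ , x[s]≢0 = s , there s∈ , x[s]≢0

  Σx≡1⇒positive≡1 : ∀ {xs s} → Σx xs ≡ fin 1 → s ∈ xs → x s ≢ fin 0 → x s ≡ fin 1
  Σx≡1⇒positive≡1 {y ∷ ys} Σ≡1 (here refl) x[s]≢0 with +∞≡1 (x y) (Σx ys) Σ≡1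
  ... | inj₁ (x[y]≡1 , _) = x[y]≡1
  ... | inj₂ (x[y]≡0 , _) = contradiction x[y]≡0 x[s]≢0
  Σx≡1⇒positive≡1 {y ∷ ys} Σ≡1 (there s∈) x[s]≢0 with +∞≡1 (x y) (Σx ys) Σ≡1
  ... | inj₁ (_ , Σys≡0) = contradiction Σys≡0 (Σx-positive s∈ x[s]≢0)
  ... | inj₂ (_ , Σys≡1) = Σx≡1⇒positive≡1 Σys≡1 s∈ x[s]≢0

  Σx≡1⇒positive-unique : ∀ {xs s s′} → Σx xs ≡ fin 1 → s ∈ xs → s′ ∈ xs →
                         x s ≢ fin 0 → x s′ ≢ fin 0 → s ≡ s′
  Σx≡1⇒positive-unique {y ∷ ys} Σ≡1 s∈ s′∈ x[s]≢0 x[s′]≢0 with +∞≡1 (x y) (Σx ys) Σ≡1 | s∈ | s′∈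
  ... | _                   | here refl | here refl = refl
  ... | inj₁ (_ , Σys≡0)    | _         | there s′∈ = contradiction Σys≡0 (Σx-positive s′∈ x[s′]≢0)
  ... | inj₁ (_ , Σys≡0)    | there s∈  | _         = contradiction Σys≡0 (Σx-positive s∈ x[s]≢0)
  ... | inj₂ (x[y]≡0 , _)   | here refl | _         = contradiction x[y]≡0 x[s]≢0
  ... | inj₂ (x[y]≡0 , _)   | _         | here refl = contradiction x[y]≡0 x[s′]≢0
  ... | inj₂ (_ , Σys≡1)    | there s∈  | there s′∈ = Σx≡1⇒positive-unique Σys≡1 s∈ s′∈ x[s]≢0 x[s′]≢0

  Σx≡0 : ∀ {xs} → (∀ {s} → s ∈ xs → x s ≡ fin 0) → Σx xs ≡ fin 0
  Σx≡0 {[]}     _     = refl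
  Σx≡0 {y ∷ ys} zeros = cong₂ _+∞_ (zeros (here refl)) (Σx≡0 (zeros ∘ there))

  Σx≡1 : ∀ {xs s} → Unique xs → s ∈ xs → x s ≡ fin 1 →
         (∀ {s′} → s′ ∈ xs → s′ ≢ s → x s′ ≡ fin 0) → Σx xs ≡ fin 1
  Σx≡1 {y ∷ ys} (y∉ys ∷ _) (here refl) x[s]≡1 zeros =
    cong₂ _+∞_ x[s]≡1 (Σx≡0 λ s′∈ → zeros (there s′∈) (All.lookup y∉ys s′∈ ∘ sym))
  Σx≡1 {y ∷ ys} (y∉ys ∷ u) (there s∈) x[s]≡1 zeros =
    cong₂ _+∞_ (zeros (here refl) (All.lookup y∉ys s∈)) (Σx≡1 u s∈ x[s]≡1 (zeros ∘ there))

module Count {A : Set} {P : Pred A 0ℓ} (P? : Decidable P) where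

  count : List A → ℕ
  count xs = length (filter P? xs)

  count-none : ∀ {xs} → (∀ {y} → y ∈ xs → ¬ P y) → count xs ≡ 0
  count-none none = cong length (filter-none P? (All.tabulate none))

  count-positive : ∀ {xs y} → y ∈ xs → P y → count xs ≢ 0
  count-positive {xs} y∈ py with filter P? xs | ∈-filter⁺ P? y∈ py
  ... | _ ∷ _ | _ = λ ()
  ... | []    | ()

  count-positive⁻ : ∀ xs → count xs ≢ 0 → ∃ P
  count-positive⁻ xs count≢0 with Any.any? P? xs
  ... | yes some = Any.satisfied some
  ... | no none  = contradiction (count-none λ y∈ py → none (Any.map (λ { refl → py }) y∈)) count≢0

  count≡1⇒unique : ∀ {xs y y′} → count xs ≡ 1 → y ∈ xs → y′ ∈ xs → P y → P y′ → y ≡ y′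
  count≡1⇒unique {xs} count≡1 y∈ y′∈ py py′
    with filter P? xs | ∈-filter⁺ P? y∈ py | ∈-filter⁺ P? y′∈ py′
  ... | _ ∷ [] | here refl | here refl = refl

  count≡1 : ∀ {xs y} → Unique xs → y ∈ xs → P y → (∀ {y′} → P y′ → y′ ≡ y) → count xs ≡ 1
  count≡1 {z ∷ zs} (z∉zs ∷ _) (here refl) py only with P? z
  ... | yes _  = cong suc (count-none λ y′∈ py′ → All.lookup z∉zs y′∈ (sym (only py′)))
  ... | no ¬pz = contradiction py ¬pz
  count≡1 {z ∷ zs} (z∉zs ∷ u) (there y∈) py only with P? z
  ... | yes pz = contradiction (only pz) (All.lookup z∉zs y∈)
  ... | no _   = count≡1 u y∈ py only

∈-allSubsets : ∀ {m} (s : Vec Bool m) → s ∈ allSubsets m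
∈-allSubsets []          = here refl
∈-allSubsets (true ∷ s)  = ∈-++⁺ˡ (∈-map⁺ (true ∷_) (∈-allSubsets s))
∈-allSubsets {suc m} (false ∷ s) =
  ∈-++⁺ʳ (List.map (true ∷_) (allSubsets m)) (∈-map⁺ (false ∷_) (∈-allSubsets s))

allSubsets-unique : ∀ m → Unique (allSubsets m)
allSubsets-unique zero    = [] ∷ []
allSubsets-unique (suc m) =
  UniqueP.++⁺ (UniqueP.map⁺ VecP.∷-injectiveʳ (allSubsets-unique m))
              (UniqueP.map⁺ VecP.∷-injectiveʳ (allSubsets-unique m)) disjoint
  where
    disjoint : ∀ {s} → ¬ (s ∈ List.map (true ∷_) (allSubsets m) × s ∈ List.map (false ∷_) (allSubsets m))
    disjoint (s∈ , s∈′) with ∈-map⁻ (true ∷_) s∈ | ∈-map⁻ (false ∷_) s∈′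
    ... | _ , _ , refl | _ , _ , ()

vectors : {A : Set} → List A → ∀ k → List (Vec A k)
vectors xs zero    = [ [] ]
vectors xs (suc k) = cartesianProductWith _∷_ xs (vectors xs k)

∈-vectors : ∀ {A : Set} {xs : List A} → (∀ a → a ∈ xs) → ∀ {k} (v : Vec A k) → v ∈ vectors xs k
∈-vectors ∈xs []      = here refl
∈-vectors ∈xs (a ∷ v) = ∈-cartesianProductWith⁺ _∷_ (∈xs a) (∈-vectors ∈xs v)

lookup-injective : ∀ {A : Set} {xs : List A} → Unique xs → ∀ i j → lookup xs i ≡ lookup xs j → i ≡ j
lookup-injective {xs = _ ∷ _}  _          Fin.zero    Fin.zero    _  = refl
lookup-injective {xs = _ ∷ _}  (x∉xs ∷ _) Fin.zero    (Fin.suc j) eq = contradiction eq (All.lookup x∉xs (∈-lookup j))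
lookup-injective {xs = _ ∷ _}  (x∉xs ∷ _) (Fin.suc i) Fin.zero    eq = contradiction (sym eq) (All.lookup x∉xs (∈-lookup i))
lookup-injective {xs = _ ∷ _}  (_ ∷ u)    (Fin.suc i) (Fin.suc j) eq = cong Fin.suc (lookup-injective u i j eq)

module FiniteImage (lem : ExcludedMiddle 0ℓ) {D T : Set} (_≟_ : DecidableEquality T)
                   (enum : List T) (∈-enum : ∀ t → t ∈ enum) (f : D → T) where

  realized? : Decidable (λ t → ∃[ d ] f d ≡ t)
  realized? t = lem

  image : List T
  image = deduplicate _≟_ (filter realized? enum)

  image-unique : Unique image
  image-unique = DecUniqueP.deduplicate-! _≟_ _

  image-sound : ∀ i → ∃[ d ] f d ≡ lookup image i
  image-sound i = proj₂ (∈-filter⁻ realized? {xs = enum} (∈-deduplicate⁻ _≟_ _ (∈-lookup i)))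

  image-complete : ∀ d → ∃[ i ] f d ≡ lookup image i
  image-complete d = Any.index fd∈ , AnyP.lookup-index fd∈
    where fd∈ = ∈-deduplicate⁺ _≟_ (∈-filter⁺ realized? (∈-enum (f d)) (d , refl))

Compatible : ∀ {n} (C₀ : Concept n) → ℕ → Cand C₀ → Cand C₀ → Set
Compatible C₀ r t t′ = ∀ D → member C₀ (neg (∃r r D)) t → member C₀ (∼ D) t′

ext⇒Δ : ∀ {n} {F : Frame n} (M : Model F) {w} C {d} → Model.ext M w C d → Model.Δ M w d
ext⇒Δ M (atom _)  = proj₁
ext⇒Δ M (nom _)   = proj₁
ext⇒Δ M (neg _)   = proj₁
ext⇒Δ M (C ⊓ _)   = ext⇒Δ M C ∘ proj₁
ext⇒Δ M (∃r _ _)  = proj₁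
ext⇒Δ M (∃u _)    = proj₁
ext⇒Δ M (◇ _ _)   = proj₁

module FromQuasimodel {n} {C₀ : Concept n} {F : Frame n} (Q : Quasimodel C₀ F) where
  open Quasimodel Q
  open Subconcepts C₀
  open Sum∞ using (Σx-positive⁻; Σx≡1⇒positive≡1; Σx≡1⇒positive-unique)

  ρ : Fin N → World F → Maybe (Cand C₀)
  ρ a = Run.ρ (runs a)

  ρ-functional : ∀ {a w t t′} → ρ a w ≡ just t → ρ a w ≡ just t′ → t ≡ t′
  ρ-functional ρ≡t ρ≡t′ = just-injective (trans (sym ρ≡t) ρ≡t′)

  run-positive : ∀ {a w t} → ρ a w ≡ just t → qx w t ≢ fin 0
  run-positive {a} {w} {t} = Run.pos (runs a) w t

  run-type : ∀ {a w t} → ρ a w ≡ just t → IsType C₀ t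
  run-type {a} {w} {t} ρ≡ = Quasistate.onTypes (q w) t (run-positive ρ≡)

  passes? : ∀ w t a → Dec (ρ a w ≡ just t)
  passes? w t a = MaybeP.≡-dec _≟S_ (ρ a w) (just t)

  run-through : ∀ {w t} → qx w t ≢ fin 0 → ∃[ a ] ρ a w ≡ just t
  run-through {w} {t} x≢0 =
    Count.count-positive⁻ (passes? w t) (allFin N) (λ count≡0 → x≢0 (trans (sym (M1 w t)) (cong fin count≡0)))

  Alive : World F → Fin N → Set
  Alive w a = ∃[ t ] ρ a w ≡ just t

  alive-nonempty : ∀ w → ∃ (Alive w)
  alive-nonempty w with Σx-positive⁻ (qx w) (allSubsets (∣con∣ C₀)) (Quasistate.nonzero (q w))
  ... | t , _ , x≢0 with run-through x≢0
  ...   | a , ρ≡ = a , t , ρ≡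

  alive-expand : ∀ {w v a} → R F w v → Alive w a → Alive v a
  alive-expand {a = a} [ wv ]⁺   (t , ρ≡) = Run.closed (runs a) _ _ t ρ≡ wv
  alive-expand {a = a} (wu ∷ uv) (t , ρ≡) = alive-expand uv (Run.closed (runs a) _ _ t ρ≡ wu)

  Named : ℕ → World F → Fin N → Set
  Named a w b = ∃[ t ] (ρ b w ≡ just t × member C₀ (nom a) t)

  named? : ∀ a w b → Dec (Named a w b)
  named? a w b with ρ b w
  ... | nothing = no λ { (_ , () , _) }
  ... | just t with member? C₀ (nom a) t
  ...   | yes m = yes (t , refl , m)
  ...   | no ¬m = no λ { (_ , refl , m) → ¬m m }

  named-exists : ∀ {a} w → nom a ∈con C₀ → ∃ (Named a w)
  named-exists {a} w c
    with Σx-positive⁻ (qx w) (filter (member? C₀ (nom a)) (allSubsets (∣con∣ C₀)))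
                      (λ Σ≡0 → one≢zero (trans (sym (Quasistate.Q1 (q w) a c)) Σ≡0))
    where one≢zero : fin 1 ≢ fin 0
          one≢zero ()
  ... | t , t∈ , x≢0 with run-through x≢0
  ...   | b , ρ≡ = b , t , ρ≡ , proj₂ (∈-filter⁻ (member? C₀ (nom a)) {xs = allSubsets _} t∈)

  module _ {a : ℕ} {w : World F} (c : nom a ∈con C₀) where
    private
      nominal∈ : ∀ {t} → member C₀ (nom a) t → t ∈ filter (member? C₀ (nom a)) (allSubsets (∣con∣ C₀))
      nominal∈ {t} = ∈-filter⁺ (member? C₀ (nom a)) (∈-allSubsets t)

    nominal-type-unique : ∀ {t t′} → member C₀ (nom a) t → member C₀ (nom a) t′ →
                          qx w t ≢ fin 0 → qx w t′ ≢ fin 0 → t ≡ t′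
    nominal-type-unique m m′ =
      Σx≡1⇒positive-unique (qx w) (Quasistate.Q1 (q w) a c) (nominal∈ m) (nominal∈ m′)

    nominal-type-single : ∀ {t} → member C₀ (nom a) t → qx w t ≢ fin 0 →
                          Count.count (passes? w t) (allFin N) ≡ 1
    nominal-type-single {t} m x≢0 =
      fin-injective (trans (M1 w t) (Σx≡1⇒positive≡1 (qx w) (Quasistate.Q1 (q w) a c) (nominal∈ m) x≢0))

  named-unique : ∀ {a w b b′} → Named a w b → Named a w b′ → b ≡ b′
  named-unique {w = w} {b} {b′} (t , ρ≡ , m) (t′ , ρ≡′ , m′)
    with refl ← nominal-type-unique (member⇒con m) m m′ (run-positive ρ≡) (run-positive ρ≡′) =
    Count.count≡1⇒unique (passes? w t) (nominal-type-single (member⇒con m) m (run-positive ρ≡))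
                         (∈-allFin b) (∈-allFin b′) ρ≡ ρ≡′

  -- Names absent from C₀ are interpreted by an arbitrary alive run.
  nominal : World F → ℕ → Fin N
  nominal w a with any? (named? a w)
  ... | yes (b , _) = b
  ... | no _        = proj₁ (alive-nonempty w)

  nominal-alive : ∀ w a → Alive w (nominal w a)
  nominal-alive w a with any? (named? a w)
  ... | yes (_ , t , ρ≡ , _) = t , ρ≡
  ... | no _                 = proj₂ (alive-nonempty w)

  nominal-named : ∀ {a} w → nom a ∈con C₀ → Named a w (nominal w a)
  nominal-named {a} w c with any? (named? a w)
  ... | yes (_ , named) = named
  ... | no ¬named       = contradiction (named-exists w c) ¬named

  model : Model F
  model = record
    { D           = Fin N
    ; Δ           = Alive
    ; Δ-ne        = alive-nonempty
    ; expand      = alive-expand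
    ; conceptI    = λ w A b → ∃[ t ] (ρ b w ≡ just t × member C₀ (atom A) t)
    ; conceptI⊆Δ  = λ { _ _ _ (t , ρ≡ , _) → t , ρ≡ }
    ; roleI       = λ w r b e → ∃[ t ] ∃[ t′ ] (ρ b w ≡ just t × ρ e w ≡ just t′ × Compatible C₀ r t t′)
    ; roleI⊆Δ     = λ { _ _ _ _ (t , t′ , ρ≡ , ρ≡′ , _) → (t , ρ≡) , (t′ , ρ≡′) }
    ; indI        = nominal
    ; indI∈Δ      = nominal-alive
    }

  open Model model using (ext)

  Truth : Concept n → Set
  Truth C = ∀ {w b t} → ρ b w ≡ just t → ext w C b ⟷ member C₀ C t

  truth-atom : ∀ {A} → Truth (atom A)
  truth-atom ρ≡ = (λ { (_ , _ , ρ≡′ , m) → subst (member C₀ _) (ρ-functional ρ≡′ ρ≡) m })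
                , λ m → (_ , ρ≡) , _ , ρ≡ , m

  truth-nom : ∀ {a} → nom a ∈con C₀ → Truth (nom a)
  truth-nom {a} c {w} ρ≡ = to , from
    where
      to : ext w (nom a) _ → member C₀ (nom a) _
      to (_ , refl) with nominal-named w c
      ... | _ , ρ≡′ , m = subst (member C₀ (nom a)) (ρ-functional ρ≡′ ρ≡) m
      from : member C₀ (nom a) _ → ext w (nom a) _
      from m = (_ , ρ≡) , named-unique (_ , ρ≡ , m) (nominal-named w c)

  truth-neg : ∀ {C} → neg C ∈con C₀ → Truth C → Truth (neg C)
  truth-neg {C} c ih ρ≡ =
    (λ { (_ , ¬x) → decidable-stable (member? C₀ (neg C) _) λ ¬m → ¬x (proj₂ (ih ρ≡) (proj₂ C⇔¬negC ¬m)) })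
    , λ m → (_ , ρ≡) , λ x → proj₁ C⇔¬negC (proj₁ (ih ρ≡) x) m
    where C⇔¬negC = proj₁ (run-type ρ≡) (neg C) c

  truth-⊓ : ∀ {C D} → (C ⊓ D) ∈con C₀ → Truth C → Truth D → Truth (C ⊓ D)
  truth-⊓ c ihC ihD ρ≡ =
    (λ { (x , y) → proj₂ ⊓⇔ (proj₁ (ihC ρ≡) x , proj₁ (ihD ρ≡) y) })
    , λ m → proj₂ (ihC ρ≡) (proj₁ (proj₁ ⊓⇔ m)) , proj₂ (ihD ρ≡) (proj₂ (proj₁ ⊓⇔ m))
    where ⊓⇔ = proj₂ (run-type ρ≡) _ _ c

  -- A witness e of ∃r.C is r-compatible with b, so ¬∃r.C ∈ t would force ∼C into the type of e.
  truth-∃r : ∀ {r C} → ∃r r C ∈con C₀ → C ∈con C₀ → Truth C → Truth (∃r r C)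
  truth-∃r {r} {C} c cC ih {w} {b} {t} ρ≡ = to , from
    where
      to : ext w (∃r r C) b → member C₀ (∃r r C) t
      to (_ , e , _ , (t₁ , t₂ , ρ≡₁ , ρ≡₂ , compatible) , x) =
        decidable-stable (member? C₀ (∃r r C) t) λ ¬m →
          let ¬∃∈t₁ = subst (member C₀ (neg (∃r r C))) (ρ-functional ρ≡ ρ≡₁) (proj₂ (proj₁ (run-type ρ≡) (∃r r C) c) ¬m)
          in proj₁ (proj₁ (run-type ρ≡₂) C cC) (compatible C ¬∃∈t₁) (proj₁ (ih ρ≡₂) x)
      from : member C₀ (∃r r C) t → ext w (∃r r C) b
      from m with Quasistate.Q2 (q w) t (run-positive ρ≡) r C m
      ... | t′ , x≢0 , mC , compatible with run-through x≢0
      ...   | e , ρ≡′ = (t , ρ≡) , e , (t′ , ρ≡′) , (t , t′ , ρ≡ , ρ≡′ , compatible) , proj₂ (ih ρ≡′) mC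

  truth-∃u : ∀ {C} → ∃u C ∈con C₀ → Truth C → Truth (∃u C)
  truth-∃u {C} c ih {w} {b} {t} ρ≡ = to , from
    where
      Q3 = Quasistate.Q3 (q w) t (run-positive ρ≡) C c
      to : ext w (∃u C) b → member C₀ (∃u C) t
      to (_ , e , (t′ , ρ≡′) , x) = proj₂ Q3 (t′ , run-positive ρ≡′ , proj₁ (ih ρ≡′) x)
      from : member C₀ (∃u C) t → ext w (∃u C) b
      from m with proj₁ Q3 m
      ... | t′ , x≢0 , mC with run-through x≢0
      ...   | e , ρ≡′ = (t , ρ≡) , e , (t′ , ρ≡′) , proj₂ (ih ρ≡′) mC

  truth-◇ : ∀ {i C} → ◇ i C ∈con C₀ → Truth C → Truth (◇ i C)
  truth-◇ {i} {C} c ih {w} {b} {t} ρ≡ = to , from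
    where
      to : ext w (◇ i C) b → member C₀ (◇ i C) t
      to (_ , v , wv , x) with ext⇒Δ model C x
      ... | t′ , ρ≡′ = Run.R1 (runs b) i C c w t ρ≡ (v , t′ , wv , ρ≡′ , proj₁ (ih ρ≡′) x)
      from : member C₀ (◇ i C) t → ext w (◇ i C) b
      from m with Run.R2 (runs b) i C c w t ρ≡ m
      ... | v , t′ , wv , ρ≡′ , mC = (t , ρ≡) , v , wv , proj₂ (ih ρ≡′) mC

  truth : ∀ {C} → Sub C → Truth C
  truth {atom _}  _ = truth-atom
  truth {nom _}   p = truth-nom (sub⇒con p)
  truth {neg _}   p = truth-neg (sub⇒con p) (truth (sub-neg p))
  truth {_ ⊓ _}   p = truth-⊓ (sub⇒con p) (truth (sub-⊓ˡ p)) (truth (sub-⊓ʳ p))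
  truth {∃r _ _}  p = truth-∃r (sub⇒con p) (sub⇒con (sub-∃r p)) (truth (sub-∃r p))
  truth {∃u _}    p = truth-∃u (sub⇒con p) (truth (sub-∃u p))
  truth {◇ _ _}   p = truth-◇ (sub⇒con p) (truth (sub-◇ p))

  satAtRoot : SatAtRoot C₀ F
  satAtRoot with rootOK
  ... | t , x≢0 , m with run-through x≢0
  ...   | b , ρ≡ = model , b , proj₂ (truth (sub-self C₀) ρ≡) m

module _ {m} {P : Pred (Fin m) 0ℓ} (P? : Decidable P) where

  ∈-tabulate⁺ : ∀ {p} → P p → p ∈ₛ Vec.tabulate (isYes ∘ P?)
  ∈-tabulate⁺ {p} pp =
    VecP.lookup⇒[]= p _ (trans (VecP.lookup∘tabulate _ p) (Equivalence.to T-≡ (fromWitness {a? = P? p} pp)))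

  ∈-tabulate⁻ : ∀ {p} → p ∈ₛ Vec.tabulate (isYes ∘ P?) → P p
  ∈-tabulate⁻ {p} p∈ =
    toWitness {a? = P? p} (Equivalence.from T-≡ (trans (sym (VecP.lookup∘tabulate _ p)) (VecP.[]=⇒lookup p∈)))

module WorldIndex {n} (F : Frame n) where
  open Frame F

  world-≡ : ∀ {w v : World F} → proj₁ w ≡ proj₁ v → w ≡ v
  world-≡ {_ , w∈} {_ , v∈} refl = cong (_ ,_) (T-irrelevant w∈ v∈)

  worldAt : Fin (length words) → World F
  worldAt j = lookup words j , fromWitness (∈-lookup j)

  index : World F → Fin (length words)
  index (_ , w∈) = Any.index (toWitness w∈)

  worldAt-index : ∀ w → worldAt (index w) ≡ w
  worldAt-index (_ , w∈) = world-≡ (sym (AnyP.lookup-index (toWitness w∈)))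

module FromModel (lem : ExcludedMiddle 0ℓ) {n} {C₀ : Concept n} {F : Frame n} (M : Model F) where
  open Model M
  open Subconcepts C₀
  open WorldIndex F

  holds? : ∀ w d → Decidable (λ p → ext w (lookup (con C₀) p) d)
  holds? w d p = lem

  typeOf : World F → D → Cand C₀
  typeOf w d = Vec.tabulate (isYes ∘ holds? w d)

  ∈typeOf⁺ : ∀ {w C d} → C ∈con C₀ → ext w C d → member C₀ C (typeOf w d)
  ∈typeOf⁺ {w} {d = d} (p , refl) x = p , refl , ∈-tabulate⁺ (holds? w d) x

  ∈typeOf⁻ : ∀ {w C d} → member C₀ C (typeOf w d) → ext w C d
  ∈typeOf⁻ {w} {d = d} (p , refl , p∈) = ∈-tabulate⁻ (holds? w d) p∈

  ext-∼⁺ : ∀ {w d} C → Δ w d → ¬ ext w C d → ext w (∼ C) d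
  ext-∼⁺ (atom _)  δ ¬x = δ , ¬x
  ext-∼⁺ (nom _)   δ ¬x = δ , ¬x
  ext-∼⁺ (neg C)   δ ¬x = decidable-stable lem λ ¬y → ¬x (δ , ¬y)
  ext-∼⁺ (_ ⊓ _)   δ ¬x = δ , ¬x
  ext-∼⁺ (∃r _ _)  δ ¬x = δ , ¬x
  ext-∼⁺ (∃u _)    δ ¬x = δ , ¬x
  ext-∼⁺ (◇ _ _)   δ ¬x = δ , ¬x

  ext-∼⁻ : ∀ {w d} C → ext w (∼ C) d → ¬ ext w C d
  ext-∼⁻ (atom _)  = proj₂
  ext-∼⁻ (nom _)   = proj₂
  ext-∼⁻ (neg C)   = λ x (_ , ¬x) → ¬x x
  ext-∼⁻ (_ ⊓ _)   = proj₂
  ext-∼⁻ (∃r _ _)  = proj₂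
  ext-∼⁻ (∃u _)    = proj₂
  ext-∼⁻ (◇ _ _)   = proj₂

  typeOf-isType : ∀ {w d} → Δ w d → IsType C₀ (typeOf w d)
  typeOf-isType δ =
      (λ C c → (λ m∼ m → ext-∼⁻ C (∈typeOf⁻ m∼) (∈typeOf⁻ m))
             , λ ¬m → ∈typeOf⁺ (∼-con c) (ext-∼⁺ C δ (¬m ∘ ∈typeOf⁺ c)))
    , (λ C D c → (λ m → ∈typeOf⁺ (proj₁ (⊓-con c)) (proj₁ (∈typeOf⁻ m))
                      , ∈typeOf⁺ (proj₂ (⊓-con c)) (proj₂ (∈typeOf⁻ m)))
               , λ { (mC , mD) → ∈typeOf⁺ c (∈typeOf⁻ mC , ∈typeOf⁻ mD) })

  ∃r-successor : ∀ {w d r C} → Δ w d → member C₀ (∃r r C) (typeOf w d) →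
                 ∃[ e ] (Δ w e × member C₀ C (typeOf w e) × Compatible C₀ r (typeOf w d) (typeOf w e))
  ∃r-successor δ m with ∈typeOf⁻ m
  ... | _ , e , δe , de , x =
    e , δe , ∈typeOf⁺ (∃r-con (member⇒con m)) x ,
    λ D m¬ → ∈typeOf⁺ (¬∃r-con (member⇒con m¬)) (ext-∼⁺ D δe λ y → proj₂ (∈typeOf⁻ m¬) (δ , e , δe , de , y))

  ∃u-member : ∀ {w d C} → Δ w d → ∃u C ∈con C₀ →
              member C₀ (∃u C) (typeOf w d) ⟷ (∃[ e ] (Δ w e × member C₀ C (typeOf w e)))
  ∃u-member δ c = (λ m → let (_ , e , δe , x) = ∈typeOf⁻ m in e , δe , ∈typeOf⁺ (∃u-con c) x)
                , λ { (e , δe , mC) → ∈typeOf⁺ c (δ , e , δe , ∈typeOf⁻ mC) }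

  trace : D → World F → Maybe (Cand C₀)
  trace d w with lem {Δ w d}
  ... | yes _ = just (typeOf w d)
  ... | no _  = nothing

  trace-alive : ∀ {w d} → Δ w d → trace d w ≡ just (typeOf w d)
  trace-alive {w} {d} δ with lem {Δ w d}
  ... | yes _ = refl
  ... | no ¬δ = contradiction δ ¬δ

  trace≡just : ∀ {w d t} → trace d w ≡ just t → Δ w d × typeOf w d ≡ t
  trace≡just {w} {d} eq with lem {Δ w d} | eq
  ... | yes δ | refl = δ , refl
  ... | no _  | ()

  traceVec : D → Vec (Maybe (Cand C₀)) (length (Frame.words F))
  traceVec d = Vec.tabulate (trace d ∘ worldAt)

  maybeTypes : List (Maybe (Cand C₀))
  maybeTypes = nothing ∷ List.map just (allSubsets (∣con∣ C₀))

  ∈-maybeTypes : ∀ x → x ∈ maybeTypes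
  ∈-maybeTypes nothing  = here refl
  ∈-maybeTypes (just t) = there (∈-map⁺ just (∈-allSubsets t))

  open ≡-Reasoning
  open FiniteImage lem (VecP.≡-dec (MaybeP.≡-dec _≟S_)) (vectors maybeTypes _) (∈-vectors ∈-maybeTypes) traceVec

  N : ℕ
  N = length image

  ρ : Fin N → World F → Maybe (Cand C₀)
  ρ a w = Vec.lookup (lookup image a) (index w)

  ρ-trace : ∀ {a d} → traceVec d ≡ lookup image a → ∀ w → ρ a w ≡ trace d w
  ρ-trace {a} {d} eq w = begin
    Vec.lookup (lookup image a) (index w)  ≡⟨ cong (λ v → Vec.lookup v (index w)) (sym eq) ⟩
    Vec.lookup (traceVec d) (index w)      ≡⟨ VecP.lookup∘tabulate (trace d ∘ worldAt) (index w) ⟩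
    trace d (worldAt (index w))            ≡⟨ cong (trace d) (worldAt-index w) ⟩
    trace d w                              ∎

  ρ-realized : ∀ {a w t} → ρ a w ≡ just t →
               ∃[ d ] (Δ w d × typeOf w d ≡ t × traceVec d ≡ lookup image a)
  ρ-realized {a} {w} ρ≡ with image-sound a
  ... | d , eq with trace≡just (trans (sym (ρ-trace eq w)) ρ≡)
  ...   | δ , refl = d , δ , refl , eq

  passes? : ∀ w t a → Dec (ρ a w ≡ just t)
  passes? w t a = MaybeP.≡-dec _≟S_ (ρ a w) (just t)

  count : World F → Cand C₀ → ℕ
  count w t = Count.count (passes? w t) (allFin N)

  x : World F → Cand C₀ → ℕ∞
  x w t = fin (count w t)

  x-positive : ∀ {w d} → Δ w d → x w (typeOf w d) ≢ fin 0
  x-positive {w} {d} δ =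
    let a , eq = image-complete d
    in Count.count-positive (passes? w _) (∈-allFin a) (trans (ρ-trace eq w) (trace-alive δ)) ∘ fin-injective

  x-positive⁻ : ∀ {w t} → x w t ≢ fin 0 → ∃[ d ] (Δ w d × typeOf w d ≡ t)
  x-positive⁻ {w} {t} x≢0 with Count.count-positive⁻ (passes? w t) (allFin N) (x≢0 ∘ cong fin)
  ... | a , ρ≡ with ρ-realized ρ≡
  ...   | d , δ , eq , _ = d , δ , eq

  named-run : ∀ {a w b t} → ρ b w ≡ just t → member C₀ (nom a) t →
              typeOf w (indI w a) ≡ t × traceVec (indI w a) ≡ lookup image b
  named-run ρ≡ m with ρ-realized ρ≡
  ... | d , _ , refl , eq with ∈typeOf⁻ m
  ...   | _ , refl = refl , eq

  x-nominal≡1 : ∀ {a} w → nom a ∈con C₀ → x w (typeOf w (indI w a)) ≡ fin 1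
  x-nominal≡1 {a} w c =
    let a₀ , eq₀ = image-complete (indI w a)
        named    = ∈typeOf⁺ c (indI∈Δ w a , refl)
    in cong fin (Count.count≡1 (passes? w _) (UniqueP.allFin⁺ N) (∈-allFin a₀)
                  (trans (ρ-trace eq₀ w) (trace-alive (indI∈Δ w a)))
                  λ {b} ρ≡ → lookup-injective image-unique b a₀ (trans (sym (proj₂ (named-run ρ≡ named))) eq₀))

  x-nominal≡0 : ∀ {a w t} → member C₀ (nom a) t → t ≢ typeOf w (indI w a) → x w t ≡ fin 0
  x-nominal≡0 {w = w} {t} m t≢ =
    cong fin (Count.count-none (passes? w t) {allFin N} λ _ ρ≡ → t≢ (sym (proj₁ (named-run ρ≡ m))))

  x-Q1 : ∀ w a → nom a ∈con C₀ →
         sum∞ (List.map (x w) (filter (member? C₀ (nom a)) (allSubsets (∣con∣ C₀)))) ≡ fin 1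
  x-Q1 w a c =
    Sum∞.Σx≡1 (x w) (UniqueP.filter⁺ (member? C₀ (nom a)) (allSubsets-unique _))
      (∈-filter⁺ (member? C₀ (nom a)) (∈-allSubsets _) (∈typeOf⁺ c (indI∈Δ w a , refl)))
      (x-nominal≡1 w c)
      λ t∈ → x-nominal≡0 (proj₂ (∈-filter⁻ (member? C₀ (nom a)) {xs = allSubsets _} t∈))

  x-Q2 : ∀ {w t} → x w t ≢ fin 0 → ∀ {r C} → member C₀ (∃r r C) t →
         ∃[ t′ ] (x w t′ ≢ fin 0 × member C₀ C t′ × Compatible C₀ r t t′)
  x-Q2 {w} x≢0 m =
    let _ , δ , eq               = x-positive⁻ x≢0
        e , δe , mC , compatible = ∃r-successor δ (subst (member C₀ _) (sym eq) m)
    in typeOf w e , x-positive δe , mC , λ D → compatible D ∘ subst (member C₀ _) (sym eq)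

  x-Q3 : ∀ {w t} → x w t ≢ fin 0 → ∀ {C} → ∃u C ∈con C₀ →
         member C₀ (∃u C) t ⟷ (∃[ t′ ] (x w t′ ≢ fin 0 × member C₀ C t′))
  x-Q3 {w} x≢0 c =
    let _ , δ , eq = x-positive⁻ x≢0
        ∃u⇔        = ∃u-member δ c
    in (λ m → let e , δe , mC = proj₁ ∃u⇔ (subst (member C₀ _) (sym eq) m)
              in typeOf w e , x-positive δe , mC)
     , λ { (_ , x≢0′ , mC) → let e , δe , eq′ = x-positive⁻ x≢0′
                              in subst (member C₀ _) eq (proj₂ ∃u⇔ (e , δe , subst (member C₀ _) (sym eq′) mC)) }

  quasistate : World F → Quasistate C₀
  quasistate w = record
    { x       = x w
    ; onTypes = λ t x≢0 → let _ , δ , eq = x-positive⁻ x≢0 in subst (IsType C₀) eq (typeOf-isType δ)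
    ; nonzero = let _ , δ = Δ-ne w in Sum∞.Σx-positive (x w) (∈-allSubsets _) (x-positive δ)
    ; Q1      = x-Q1 w
    ; Q2      = λ t x≢0 r C → x-Q2 x≢0
    ; Q3      = λ t x≢0 C → x-Q3 x≢0
    }

  module _ (a : Fin N) where
    private
      d : D
      d = proj₁ (image-sound a)

    run-alive : ∀ {w t} → ρ a w ≡ just t → Δ w d × typeOf w d ≡ t
    run-alive {w} ρ≡ = trace≡just (trans (sym (ρ-trace (proj₂ (image-sound a)) w)) ρ≡)

    run-at : ∀ {w} → Δ w d → ρ a w ≡ just (typeOf w d)
    run-at {w} δ = trans (ρ-trace (proj₂ (image-sound a)) w) (trace-alive δ)

    run-R1 : ∀ {i C} → ◇ i C ∈con C₀ → ∀ {w v t t′} → ρ a w ≡ just t → Rᵢ F i w v →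
             ρ a v ≡ just t′ → member C₀ C t′ → member C₀ (◇ i C) t
    run-R1 c ρ≡ wv ρ≡′ mC with run-alive ρ≡ | run-alive ρ≡′
    ... | δ , refl | _ , refl = ∈typeOf⁺ c (δ , _ , wv , ∈typeOf⁻ mC)

    run-R2 : ∀ {i C} → ◇ i C ∈con C₀ → ∀ {w t} → ρ a w ≡ just t → member C₀ (◇ i C) t →
             ∃[ v ] ∃[ t′ ] (Rᵢ F i w v × ρ a v ≡ just t′ × member C₀ C t′)
    run-R2 c ρ≡ m with run-alive ρ≡
    ... | _ , refl = let _ , v , wv , xC = ∈typeOf⁻ m
                     in v , _ , wv , run-at (ext⇒Δ M _ xC) , ∈typeOf⁺ (◇-con c) xC

  runs-distinct : ∀ a b → (∀ w → ρ a w ≡ ρ b w) → a ≡ b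
  runs-distinct a b ρa≗ρb =
    let _ , eqa = image-sound a
        _ , eqb = image-sound b
        traces≡ = VecP.tabulate-cong λ j →
          trans (sym (ρ-trace eqa (worldAt j))) (trans (ρa≗ρb (worldAt j)) (ρ-trace eqb (worldAt j)))
    in lookup-injective image-unique a b (trans (sym eqa) (trans traces≡ eqb))

  module _ {d₀ : D} (sat : ext (rootW F) C₀ d₀) where

    basic : BasicStructure C₀ F
    basic = record
      { q      = quasistate
      ; rootOK = typeOf (rootW F) d₀ , x-positive (ext⇒Δ M C₀ sat) , ∈typeOf⁺ (sub⇒con (sub-self C₀)) sat
      }

    run : Fin N → Run basic
    run a = record
      { ρ      = ρ a
      ; closed = λ w v t ρ≡ wv → _ , run-at a (expand [ wv ]⁺ (proj₁ (run-alive a ρ≡)))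
      ; pos    = λ w t ρ≡ → Count.count-positive (passes? w t) (∈-allFin a) ρ≡ ∘ fin-injective
      ; R1     = λ i C c w t ρ≡ (v , t′ , wv , ρ≡′ , mC) → run-R1 a c ρ≡ wv ρ≡′ mC
      ; R2     = λ i C c w t → run-R2 a c
      }

    quasimodel : Quasimodel C₀ F
    quasimodel = record
      { basic    = basic
      ; N        = N
      ; runs     = run
      ; distinct = runs-distinct
      ; M1       = λ w t → refl
      }

mainTheorem4 : ExcludedMiddle 0ℓ →
    (n : ℕ) (C₀ : Concept n) (F : Frame n) →
    (SatAtRoot C₀ F → Quasimodel C₀ F) × (Quasimodel C₀ F → SatAtRoot C₀ F)
mainTheorem4 lem n C₀ F =
    (λ { (M , d₀ , sat) → FromModel.quasimodel lem M sat })
  , FromQuasimodel.satAtRoot
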